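{- Let $m,n\in\mathbb{N}$ with $m,n\ge 1$. The number of Galois connections between an $m$-element chain and an $n$-element chain is $\binom{m+n-2}{m-1}$.
   Context: A Galois connection between posets $(P,\le_P)$ and $(Q,\le_Q)$ is a pair $(\varphi,\psi)$ of maps $\varphi:P\to Q$, $\psi:Q\to P$ such that for all $p,p_1,p_2\in P$ and $q,q_1,q_2\in Q$: $p_1\le_P p_2$ implies $\varphi p_1\ge_Q\varphi p_2$; $q_1\le_Q q_2$ implies $\psi q_1\ge_P\psi q_2$; $p\le_P\psi\varphi p$; and $q\le_Q\varphi\psi q$. An $k$-element chain is a totally ordered set with $k$ elements. -}

module Defs where

open import Data.Nat using (ℕ)
open import Data.Fin using (Fin; _≤_; _≥_)
open import Data.Product using (_×_)

-- The k-element chain is modelled as Fin k with its natural (total) order.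

-- (φ , ψ) is a Galois connection between the m-chain and the n-chain
-- (antitone Galois connection, as in the paper's definition).
record IsGaloisConnection {m n : ℕ} (φ : Fin m → Fin n) (ψ : Fin n → Fin m) : Set where
  field
    φ-antitone : ∀ p₁ p₂ → p₁ ≤ p₂ → φ p₁ ≥ φ p₂
    ψ-antitone : ∀ q₁ q₂ → q₁ ≤ q₂ → ψ q₁ ≥ ψ q₂
    p≤ψφp      : ∀ p → p ≤ ψ (φ p)
    q≤φψq      : ∀ q → q ≤ φ (ψ q)

-- An antitone Galois connection (φ , ψ) between the chains {0..a} and {0..b}
-- is the same as an adjunction  p ≤ ψ q ⇔ q ≤ φ p.  Hence ψ is determined by
-- φ, namely ψ q is the last p with q ≤ φ p, and φ must send 0 to the top b.
-- Conversely every non-increasing φ with φ 0 = b has such a ψ.  So Galois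
-- connections correspond to non-increasing sequences b ≥ φ 1 ≥ … ≥ φ a ≥ 0,
-- and these satisfy Pascal's recurrence (the first entry is b or at most b-1),
-- so there are C(a+b, a) of them.
module Submission where

open import Defs
open import Data.Nat using (ℕ; suc; _+_)
open import Data.Nat.Combinatorics using (_C_)
open import Data.Fin using (Fin)
open import Data.Vec using (Vec; tabulate)
open import Data.Product using (_×_; _,_; Σ)
open import Data.List using (List; length)
open import Data.List.Membership.Propositional using (_∈_)
open import Data.List.Relation.Unary.Unique.Propositional using (Unique)
open import Function.Bundles using (_⇔_)
open import Relation.Binary.PropositionalEquality using (_≡_)

open import Data.Nat as ℕ using (zero; z≤n; s≤s; _≤?_)
open import Data.Nat.Properties as ℕ
  using (+-identityʳ; +-suc; m≤n⇒m<n∨m≡n; m≤n⇒m≤1+n; <-irrefl; m⊓n≤n; m≤n⇒m⊓n≡m)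
open import Data.Nat.Combinatorics using (nCn≡1; nCk+nC[k+1]≡[n+1]C[k+1])
open import Data.Fin as Fin using (toℕ; fromℕ; fromℕ<; _≤_)
open import Data.Fin.Properties
  using (toℕ-injective; toℕ-fromℕ; toℕ-fromℕ<; toℕ≤pred[n]; ≤-refl; ≤-trans; ≤-antisym)
open import Data.Vec using ([]; _∷_; lookup)
open import Data.Vec.Properties using (∷-injectiveʳ; lookup∘tabulate; tabulate∘lookup; tabulate-cong)
open import Data.List using ([]; _∷_; [_]; map; _++_)
open import Data.List.Properties using (length-map; length-++; map-id-local; map-∘)
open import Data.List.Membership.Propositional.Properties
  using (∈-map⁺; ∈-map⁻; ∈-++⁺ˡ; ∈-++⁺ʳ; ∈-++⁻)
open import Data.List.Relation.Unary.Any using (here)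
import Data.List.Relation.Unary.All as All
open import Data.List.Relation.Unary.AllPairs using ([]; _∷_)
import Data.List.Relation.Unary.Unique.Propositional.Properties as Unique
open import Data.Product using (proj₁; proj₂; map₁)
open import Data.Sum using (inj₁; inj₂)
open import Data.Unit using (⊤; tt)
open import Data.Empty using (⊥-elim)
open import Function using (_∘_)
open import Function.Bundles using (Equivalence; mk⇔)
open import Relation.Nullary using (yes; no; ¬_)
open import Relation.Binary.PropositionalEquality
  using (_≗_; refl; sym; trans; cong; cong₂; subst; subst₂; module ≡-Reasoning)

open Equivalence using (to; from)

private
  variable
    a b c : ℕ

tabulate-injective : ∀ {n} {A : Set} {f g : Fin n → A} → tabulate f ≡ tabulate g → f ≗ g
tabulate-injective {f = f} {g} eq i = begin
  f i                    ≡⟨ sym (lookup∘tabulate f i) ⟩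
  lookup (tabulate f) i  ≡⟨ cong (λ v → lookup v i) eq ⟩
  lookup (tabulate g) i  ≡⟨ lookup∘tabulate g i ⟩
  g i                    ∎
  where open ≡-Reasoning

DescendingFrom : ℕ → Vec ℕ a → Set
DescendingFrom c []      = ⊤
DescendingFrom c (x ∷ v) = x ℕ.≤ c × DescendingFrom x v

descendingFrom : (a c : ℕ) → List (Vec ℕ a)
descendingFrom zero    c       = [ [] ]
descendingFrom (suc a) zero    = map (0 ∷_) (descendingFrom a 0)
descendingFrom (suc a) (suc c) =
  map (suc c ∷_) (descendingFrom a (suc c)) ++ descendingFrom (suc a) c

∈-descendingFrom⁺ : ∀ a c {v : Vec ℕ a} → DescendingFrom c v → v ∈ descendingFrom a c
∈-descendingFrom⁺ zero    c       {[]}    _ = here refl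
∈-descendingFrom⁺ (suc a) zero    {x ∷ v} (z≤n , d) = ∈-map⁺ (0 ∷_) (∈-descendingFrom⁺ a 0 d)
∈-descendingFrom⁺ (suc a) (suc c) {x ∷ v} (x≤1+c , d) with m≤n⇒m<n∨m≡n x≤1+c
... | inj₂ refl        = ∈-++⁺ˡ (∈-map⁺ (suc c ∷_) (∈-descendingFrom⁺ a (suc c) d))
... | inj₁ (s≤s x≤c) = ∈-++⁺ʳ _ (∈-descendingFrom⁺ (suc a) c (x≤c , d))

∈-descendingFrom⁻ : ∀ a c (v : Vec ℕ a) → v ∈ descendingFrom a c → DescendingFrom c v
∈-descendingFrom⁻ zero    c       []      _ = tt
∈-descendingFrom⁻ (suc a) zero    v       v∈ with ∈-map⁻ (0 ∷_) v∈
... | w , w∈ , refl = z≤n , ∈-descendingFrom⁻ a 0 w w∈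
∈-descendingFrom⁻ (suc a) (suc c) v v∈
  with ∈-++⁻ (map (suc c ∷_) (descendingFrom a (suc c))) v∈
... | inj₁ v∈′ with ∈-map⁻ (suc c ∷_) v∈′
...   | w , w∈ , refl = ℕ.≤-refl , ∈-descendingFrom⁻ a (suc c) w w∈
∈-descendingFrom⁻ (suc a) (suc c) (x ∷ v) v∈ | inj₂ v∈′ =
  map₁ m≤n⇒m≤1+n (∈-descendingFrom⁻ (suc a) c (x ∷ v) v∈′)

descendingFrom-unique : ∀ a c → Unique (descendingFrom a c)
descendingFrom-unique zero    c       = All.[] ∷ []
descendingFrom-unique (suc a) zero    = Unique.map⁺ ∷-injectiveʳ (descendingFrom-unique a 0)
descendingFrom-unique (suc a) (suc c) =
  Unique.++⁺ (Unique.map⁺ ∷-injectiveʳ (descendingFrom-unique a (suc c)))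
             (descendingFrom-unique (suc a) c)
             disjoint
  where
  disjoint : ∀ {v} → ¬ (v ∈ map (suc c ∷_) (descendingFrom a (suc c)) × v ∈ descendingFrom (suc a) c)
  disjoint (v∈ˡ , v∈ʳ) with ∈-map⁻ (suc c ∷_) v∈ˡ
  ... | _ , _ , refl = <-irrefl refl (proj₁ (∈-descendingFrom⁻ (suc a) c _ v∈ʳ))

length-descendingFrom : ∀ a c → length (descendingFrom a c) ≡ (a + c) C a
length-descendingFrom zero    c       = refl
length-descendingFrom (suc a) zero    = begin
  length (map (0 ∷_) (descendingFrom a 0)) ≡⟨ length-map (0 ∷_) (descendingFrom a 0) ⟩
  length (descendingFrom a 0)             ≡⟨ length-descendingFrom a 0 ⟩
  (a + 0) C a                             ≡⟨ cong (_C a) (+-identityʳ a) ⟩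
  a C a                                   ≡⟨ nCn≡1 a ⟩
  1                                       ≡⟨ sym (nCn≡1 (suc a)) ⟩
  suc a C suc a                           ≡⟨ cong (_C suc a) (sym (+-identityʳ (suc a))) ⟩
  (suc a + 0) C suc a                     ∎
  where open ≡-Reasoning
length-descendingFrom (suc a) (suc c) = begin
  length (map (suc c ∷_) (descendingFrom a (suc c)) ++ descendingFrom (suc a) c)
    ≡⟨ length-++ (map (suc c ∷_) (descendingFrom a (suc c))) ⟩
  length (map (suc c ∷_) (descendingFrom a (suc c))) + length (descendingFrom (suc a) c)
    ≡⟨ cong₂ _+_ (length-map (suc c ∷_) (descendingFrom a (suc c))) refl ⟩
  length (descendingFrom a (suc c)) + length (descendingFrom (suc a) c)
    ≡⟨ cong₂ _+_ (length-descendingFrom a (suc c)) (length-descendingFrom (suc a) c) ⟩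
  (a + suc c) C a + (suc a + c) C suc a
    ≡⟨ cong (λ n → (a + suc c) C a + n C suc a) (sym (+-suc a c)) ⟩
  (a + suc c) C a + (a + suc c) C suc a
    ≡⟨ nCk+nC[k+1]≡[n+1]C[k+1] (a + suc c) a ⟩
  (suc a + suc c) C suc a
    ∎
  where open ≡-Reasoning

IsAdjunction : ∀ {m n} → (Fin m → Fin n) → (Fin n → Fin m) → Set
IsAdjunction φ ψ = ∀ p q → p ≤ ψ q ⇔ q ≤ φ p

module _ {m n} {φ : Fin m → Fin n} {ψ : Fin n → Fin m} where

  adjunction⇒galois : IsAdjunction φ ψ → IsGaloisConnection φ ψ
  adjunction⇒galois adj = record
    { φ-antitone = λ p₁ p₂ p₁≤p₂ → to (adj p₁ (φ p₂)) (≤-trans p₁≤p₂ (p≤ψφp p₂))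
    ; ψ-antitone = λ q₁ q₂ q₁≤q₂ → from (adj (ψ q₂) q₁) (≤-trans q₁≤q₂ (q≤φψq q₂))
    ; p≤ψφp      = p≤ψφp
    ; q≤φψq      = q≤φψq
    }
    where
    p≤ψφp : ∀ p → p ≤ ψ (φ p)
    p≤ψφp p = from (adj p (φ p)) ≤-refl
    q≤φψq : ∀ q → q ≤ φ (ψ q)
    q≤φψq q = to (adj (ψ q) q) ≤-refl

  galois⇒adjunction : IsGaloisConnection φ ψ → IsAdjunction φ ψ
  galois⇒adjunction gc p q = mk⇔
    (λ p≤ψq → ≤-trans (q≤φψq q) (φ-antitone p (ψ q) p≤ψq))
    (λ q≤φp → ≤-trans (p≤ψφp p) (ψ-antitone q (φ p) q≤φp))
    where open IsGaloisConnection gc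

adjunction-resp-≗ : ∀ {m n} {φ φ′ : Fin m → Fin n} {ψ ψ′ : Fin n → Fin m} →
  φ ≗ φ′ → ψ ≗ ψ′ → IsAdjunction φ ψ → IsAdjunction φ′ ψ′
adjunction-resp-≗ φ≗φ′ ψ≗ψ′ adj p q =
  subst₂ (λ x y → p ≤ x ⇔ q ≤ y) (ψ≗ψ′ q) (φ≗φ′ p) (adj p q)

adjoint-unique : ∀ {m n} {φ : Fin m → Fin n} {ψ ψ′ : Fin n → Fin m} →
  IsAdjunction φ ψ → IsAdjunction φ ψ′ → ψ ≗ ψ′
adjoint-unique adj adj′ q = ≤-antisym
  (from (adj′ _ q) (to (adj _ q) ≤-refl))
  (from (adj _ q) (to (adj′ _ q) ≤-refl))

galois-φ-zero≡top : {φ : Fin (suc a) → Fin (suc b)} {ψ : Fin (suc b) → Fin (suc a)} →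
  IsGaloisConnection φ ψ → toℕ (φ Fin.zero) ≡ b
galois-φ-zero≡top {b = b} {φ} {ψ} gc = ℕ.≤-antisym (toℕ≤pred[n] (φ Fin.zero))
  (subst (ℕ._≤ toℕ (φ Fin.zero)) (toℕ-fromℕ b)
    (≤-trans (q≤φψq (fromℕ b)) (φ-antitone Fin.zero (ψ (fromℕ b)) z≤n)))
  where open IsGaloisConnection gc

antitone⇒descendingFrom : (f : Fin (suc a) → ℕ) → (∀ i j → i ≤ j → f j ℕ.≤ f i) →
  DescendingFrom (f Fin.zero) (tabulate (f ∘ Fin.suc))
antitone⇒descendingFrom {zero}  f antitone = tt
antitone⇒descendingFrom {suc a} f antitone =
    antitone Fin.zero (Fin.suc Fin.zero) z≤n
  , antitone⇒descendingFrom (f ∘ Fin.suc) (λ i j i≤j → antitone (Fin.suc i) (Fin.suc j) (s≤s i≤j))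

lookup-≤-head : (v : Vec ℕ a) → DescendingFrom c v → ∀ p → lookup (c ∷ v) p ℕ.≤ c
lookup-≤-head v       _           Fin.zero    = ℕ.≤-refl
lookup-≤-head (x ∷ v) (x≤c , d) (Fin.suc p) = ℕ.≤-trans (lookup-≤-head v d p) x≤c

leading≥ : ℕ → Vec ℕ a → Fin (suc a)
leading≥ q []      = Fin.zero
leading≥ q (x ∷ v) with q ≤? x
... | yes _ = Fin.suc (leading≥ q v)
... | no  _ = Fin.zero

leading≥-adjoint : ∀ {q} (v : Vec ℕ a) → DescendingFrom c v → q ℕ.≤ c →
  ∀ p → p ≤ leading≥ q v ⇔ q ℕ.≤ lookup (c ∷ v) p
leading≥-adjoint v _ q≤c Fin.zero = mk⇔ (λ _ → q≤c) (λ _ → z≤n)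
leading≥-adjoint {q = q} (x ∷ v) (_ , d) _ (Fin.suc p) with q ≤? x
... | yes q≤x = mk⇔ (to IH ∘ ℕ.s≤s⁻¹) (s≤s ∘ from IH)
  where IH = leading≥-adjoint v d q≤x p
... | no  q≰x = mk⇔ (λ ()) (λ q≤vₚ → ⊥-elim (q≰x (ℕ.≤-trans q≤vₚ (lookup-≤-head v d p))))

clamp : ∀ b → ℕ → Fin (suc b)
clamp b n = fromℕ< (s≤s (m⊓n≤n n b))

toℕ-clamp : ∀ {n} → n ℕ.≤ b → toℕ (clamp b n) ≡ n
toℕ-clamp {b} {n} n≤b = trans (toℕ-fromℕ< (s≤s (m⊓n≤n n b))) (m≤n⇒m⊓n≡m n≤b)

-- The clamp is the identity when v descends from b (toℕ-φ-of); it only makes φ-of total.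
φ-of : ∀ b → Vec ℕ a → Fin (suc a) → Fin (suc b)
φ-of b v p = clamp b (lookup (b ∷ v) p)

ψ-of : ∀ b → Vec ℕ a → Fin (suc b) → Fin (suc a)
ψ-of b v q = leading≥ (toℕ q) v

toℕ-φ-of : {v : Vec ℕ a} → DescendingFrom b v → ∀ p → toℕ (φ-of b v p) ≡ lookup (b ∷ v) p
toℕ-φ-of {v = v} d p = toℕ-clamp (lookup-≤-head v d p)

φ-of-ψ-of-adjunction : {v : Vec ℕ a} → DescendingFrom b v → IsAdjunction (φ-of b v) (ψ-of b v)
φ-of-ψ-of-adjunction {v = v} d p q =
  subst (λ n → p ≤ ψ-of _ v q ⇔ toℕ q ℕ.≤ n) (sym (toℕ-φ-of d p))
    (leading≥-adjoint v d (toℕ≤pred[n] q) p)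

Table : ℕ → ℕ → Set
Table a b = Vec (Fin (suc b)) (suc a) × Vec (Fin (suc a)) (suc b)

table : ∀ b → Vec ℕ a → Table a b
table b v = tabulate (φ-of b v) , tabulate (ψ-of b v)

sequence : Table a b → Vec ℕ a
sequence (φs , _) = tabulate (λ i → toℕ (lookup φs (Fin.suc i)))

sequence-table : {v : Vec ℕ a} → DescendingFrom b v → sequence (table b v) ≡ v
sequence-table {b = b} {v} d = begin
  tabulate (λ i → toℕ (lookup (tabulate (φ-of b v)) (Fin.suc i)))
    ≡⟨ tabulate-cong (λ i → cong toℕ (lookup∘tabulate (φ-of b v) (Fin.suc i))) ⟩
  tabulate (λ i → toℕ (φ-of b v (Fin.suc i)))
    ≡⟨ tabulate-cong (toℕ-φ-of d ∘ Fin.suc) ⟩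
  tabulate (lookup v)
    ≡⟨ tabulate∘lookup v ⟩
  v ∎
  where open ≡-Reasoning

galoisConnections : (a b : ℕ) → List (Table a b)
galoisConnections a b = map (table b) (descendingFrom a b)

galoisConnections-unique : ∀ a b → Unique (galoisConnections a b)
galoisConnections-unique a b =
  Unique.map⁻ (subst Unique (sym sequence-galoisConnections) (descendingFrom-unique a b))
  where
  sequence-galoisConnections : map sequence (galoisConnections a b) ≡ descendingFrom a b
  sequence-galoisConnections = trans (sym (map-∘ (descendingFrom a b)))
    (map-id-local (All.tabulate (sequence-table ∘ ∈-descendingFrom⁻ a b _)))

module _ {φ : Fin (suc a) → Fin (suc b)} {ψ : Fin (suc b) → Fin (suc a)} where

  galois⇒∈ : IsGaloisConnection φ ψ → (tabulate φ , tabulate ψ) ∈ galoisConnections a b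
  galois⇒∈ gc = subst (_∈ galoisConnections a b)
    (cong₂ _,_ (tabulate-cong φ-of≗φ) (tabulate-cong ψ-of≗ψ))
    (∈-map⁺ (table b) (∈-descendingFrom⁺ a b descending))
    where
    open IsGaloisConnection gc
    v : Vec ℕ a
    v = tabulate (toℕ ∘ φ ∘ Fin.suc)
    top : toℕ (φ Fin.zero) ≡ b
    top = galois-φ-zero≡top gc
    descending : DescendingFrom b v
    descending = subst (λ c → DescendingFrom c v) top (antitone⇒descendingFrom (toℕ ∘ φ) φ-antitone)
    φ-of≗φ : φ-of b v ≗ φ
    φ-of≗φ p = toℕ-injective (begin
      toℕ (φ-of b v p)               ≡⟨ toℕ-φ-of descending p ⟩
      lookup (b ∷ v) p               ≡⟨ cong (λ w → lookup (w ∷ v) p) (sym top) ⟩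
      lookup (tabulate (toℕ ∘ φ)) p  ≡⟨ lookup∘tabulate (toℕ ∘ φ) p ⟩
      toℕ (φ p)                      ∎)
      where open ≡-Reasoning
    ψ-of≗ψ : ψ-of b v ≗ ψ
    ψ-of≗ψ = adjoint-unique
      (adjunction-resp-≗ φ-of≗φ (λ _ → refl) (φ-of-ψ-of-adjunction descending))
      (galois⇒adjunction gc)

  ∈⇒galois : (tabulate φ , tabulate ψ) ∈ galoisConnections a b → IsGaloisConnection φ ψ
  ∈⇒galois tables∈ with ∈-map⁻ (table b) tables∈
  ... | v , v∈ , tables≡ = adjunction⇒galois (adjunction-resp-≗
    (sym ∘ tabulate-injective (cong proj₁ tables≡))
    (sym ∘ tabulate-injective (cong proj₂ tables≡))
    (φ-of-ψ-of-adjunction (∈-descendingFrom⁻ a b v v∈)))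

proposition3p10 : (a b : ℕ) →
    Σ (List (Vec (Fin (suc b)) (suc a) × Vec (Fin (suc a)) (suc b))) λ L →
      Unique L ×
      (∀ (φ : Fin (suc a) → Fin (suc b)) (ψ : Fin (suc b) → Fin (suc a)) →
        (IsGaloisConnection φ ψ ⇔ ((tabulate φ , tabulate ψ) ∈ L))) ×
      length L ≡ (a + b) C a
proposition3p10 a b =
    galoisConnections a b
  , galoisConnections-unique a b
  , (λ φ ψ → mk⇔ galois⇒∈ ∈⇒galois)
  , trans (length-map (table b) (descendingFrom a b)) (length-descendingFrom a b)
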